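{- Let $(F_m)_{m\ge0}$ and $(L_m)_{m\ge0}$ be the Fibonacci and Lucas sequences ($F_0=0,F_1=1$, $L_0=2,L_1=1$, both satisfying $u_{m+2}=u_{m+1}+u_m$). If $m$ is a nonnegative integer with $m\equiv 0\pmod{16}$, then for either choice of sign the Jacobi symbol satisfies \[ \left(\frac{\pm 8F_m+9L_m}{7}\right)=1. \] -}

module Defs where

open import Data.Nat using (ℕ; zero; suc)
open import Data.Integer using (ℤ; +_; -_; _*_; _-_)
open import Data.Integer.Divisibility.Signed using () renaming (_∣?_ to _∣?ℤ_)
open import Data.Bool using (Bool; true; false; if_then_else_; _∨_)
open import Relation.Nullary.Decidable using (does)

fib : ℕ → ℕ
fib 0 = 0
fib 1 = 1
fib (suc (suc m)) = fib (suc m) Data.Nat.+ fib m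

lucas : ℕ → ℕ
lucas 0 = 2
lucas 1 = 1
lucas (suc (suc m)) = lucas (suc m) Data.Nat.+ lucas m

anySquareRoot : ℤ → ℤ → ℕ → Bool
anySquareRoot a p zero = false
anySquareRoot a p (suc k) =
  does (p ∣?ℤ ((+ k) * (+ k) - a)) ∨ anySquareRoot a p k

-- Legendre symbol (a / p) for an odd prime p:
--   0 if p ∣ a, 1 if a is a nonzero quadratic residue mod p, -1 otherwise.
-- (Residues mod p are represented by 0,…,p-1.)
-- For a prime modulus the Jacobi symbol coincides with the Legendre symbol.
legendre : ℤ → ℕ → ℤ
legendre a p =
  if does ((+ p) ∣?ℤ a) then + 0
  else if anySquareRoot a (+ p) p then + 1
  else - (+ 1)

{-# OPTIONS --safe #-}
-- Every sequence with u (m+2) = u (m+1) + u m satisfies u (n+1+m) = F n · u m + F (n+1) · u (m+1);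
-- since F 15 ≡ 1 and F 16 ≡ 0 (mod 7), residues mod 7 repeat with period 16.  Hence for 16 ∣ m
-- we have F m ≡ F 0 = 0 and L m ≡ L 0 = 2, so ±8 F m + 9 L m ≡ 18 ≡ 4 = 2² (mod 7), and the
-- Legendre symbol only depends on the residue of its argument.
module Submission where

open import Defs
open import Data.Nat using (ℕ; zero; suc; _%_; _/_)
import Data.Nat as ℕ
open import Data.Nat.Properties using (+-suc; +-identityʳ)
open import Data.Nat.DivMod using (m≡m%n+[m/n]*n; [m+kn]%n≡m%n)
open import Data.Nat.Divisibility using (_∣_; divides)
import Data.Nat.Tactic.RingSolver as ℕ-Solver
open import Data.Integer using (+_; -_; _+_; _*_; _-_)
open import Data.Integer.Properties using (pos-+; pos-*; *-comm)
open import Data.Integer.Divisibility.Signed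
  using (∣m+n∣n⇒∣m; ∣m∣n⇒∣m+n; ∣m⇒∣m*n; ∣-refl)
  renaming (_∣_ to _∣ℤ_; _∣?_ to _∣?ℤ_)
open import Data.Integer.Tactic.RingSolver using (solve-∀)
open import Data.Bool using (if_then_else_; _∨_)
open import Data.Product using (_×_; _,_)
open import Function.Bundles using (_⇔_; mk⇔)
open import Relation.Nullary.Decidable using (does; does-⇔)
open import Relation.Binary.PropositionalEquality
  using (_≡_; refl; sym; trans; cong; cong₂; module ≡-Reasoning)

∣-+-multiple : ∀ d c k → d ∣ℤ c + d * k ⇔ d ∣ℤ c
∣-+-multiple d c k = mk⇔ (λ d∣c+dk → ∣m+n∣n⇒∣m d∣c+dk d∣dk) (λ d∣c → ∣m∣n⇒∣m+n d∣c d∣dk)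
  where d∣dk = ∣m⇒∣m*n k ∣-refl

anySquareRoot-+-multiple : ∀ a d k n → anySquareRoot (a + d * k) d n ≡ anySquareRoot a d n
anySquareRoot-+-multiple a d k zero = refl
anySquareRoot-+-multiple a d k (suc n) =
  cong₂ _∨_ same-test (anySquareRoot-+-multiple a d k n)
  where
  x² = (+ n) * (+ n)
  shifted : ∀ c b e j → c - (b + e * j) ≡ (c - b) + e * (- j)
  shifted = solve-∀
  same-test : does (d ∣?ℤ (x² - (a + d * k))) ≡ does (d ∣?ℤ (x² - a))
  same-test rewrite shifted x² a d k = does-⇔ (∣-+-multiple d (x² - a) (- k)) (d ∣?ℤ _) (d ∣?ℤ _)

legendre-+-multiple : ∀ a p k → legendre (a + + p * k) p ≡ legendre a p
legendre-+-multiple a p k =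
  cong₂ (λ divisible residue → if divisible then + 0 else if residue then + 1 else - + 1)
        (does-⇔ (∣-+-multiple (+ p) a k) (+ p ∣?ℤ _) (+ p ∣?ℤ _))
        (anySquareRoot-+-multiple a (+ p) k p)

-- Since 4 = 2² is a nonzero square mod 7, legendre (+ 4) 7 evaluates to + 1.
legendre-4+7k : ∀ k → legendre (+ 4 + + 7 * k) 7 ≡ + 1
legendre-4+7k k = legendre-+-multiple (+ 4) 7 k

IsFibonacciLike : (ℕ → ℕ) → Set
IsFibonacciLike u = ∀ m → u (suc (suc m)) ≡ u (suc m) ℕ.+ u m

fib-isFibonacciLike : IsFibonacciLike fib
fib-isFibonacciLike m = refl

lucas-isFibonacciLike : IsFibonacciLike lucas
lucas-isFibonacciLike m = refl

fibonacciLike-+ : ∀ u → IsFibonacciLike u →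
  ∀ n m → u (suc n ℕ.+ m) ≡ fib n ℕ.* u m ℕ.+ fib (suc n) ℕ.* u (suc m)
fibonacciLike-+ u rec zero m = sym (+-identityʳ (u (suc m)))
fibonacciLike-+ u rec (suc n) m = begin
  u (suc (suc n) ℕ.+ m)                     ≡⟨ cong (λ i → u (suc i)) (+-suc n m) ⟨
  u (suc n ℕ.+ suc m)                       ≡⟨ fibonacciLike-+ u rec n (suc m) ⟩
  fib n ℕ.* u (suc m) ℕ.+ fib (suc n) ℕ.* u (suc (suc m))
                                            ≡⟨ cong (λ v → fib n ℕ.* u (suc m) ℕ.+ fib (suc n) ℕ.* v) (rec m) ⟩
  fib n ℕ.* u (suc m) ℕ.+ fib (suc n) ℕ.* (u (suc m) ℕ.+ u m)
                                            ≡⟨ regroup (fib n) (fib (suc n)) (u m) (u (suc m)) ⟩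
  fib (suc n) ℕ.* u m ℕ.+ (fib (suc n) ℕ.+ fib n) ℕ.* u (suc m) ∎
  where
  open ≡-Reasoning
  regroup : ∀ a b x y → a ℕ.* y ℕ.+ b ℕ.* (y ℕ.+ x) ≡ b ℕ.* x ℕ.+ (b ℕ.+ a) ℕ.* y
  regroup = ℕ-Solver.solve-∀

-- fib 15 = 610 = 1 + 87 · 7 and fib 16 = 987 = 141 · 7: the Pisano period of 7 is 16.
fibonacciLike-%7-period : ∀ u → IsFibonacciLike u → ∀ m → u (16 ℕ.+ m) % 7 ≡ u m % 7
fibonacciLike-%7-period u rec m = begin
  u (16 ℕ.+ m) % 7                                     ≡⟨ cong (_% 7) (fibonacciLike-+ u rec 15 m) ⟩
  (610 ℕ.* u m ℕ.+ 987 ℕ.* u (suc m)) % 7              ≡⟨ cong (_% 7) (split (u m) (u (suc m))) ⟩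
  (u m ℕ.+ (87 ℕ.* u m ℕ.+ 141 ℕ.* u (suc m)) ℕ.* 7) % 7 ≡⟨ [m+kn]%n≡m%n (u m) (87 ℕ.* u m ℕ.+ 141 ℕ.* u (suc m)) 7 ⟩
  u m % 7                                              ∎
  where
  open ≡-Reasoning
  split : ∀ x y → 610 ℕ.* x ℕ.+ 987 ℕ.* y ≡ x ℕ.+ (87 ℕ.* x ℕ.+ 141 ℕ.* y) ℕ.* 7
  split = ℕ-Solver.solve-∀

periodic-at-multiples : ∀ {a} {A : Set a} (f : ℕ → A) p →
  (∀ m → f (p ℕ.+ m) ≡ f m) → ∀ q → f (q ℕ.* p) ≡ f 0
periodic-at-multiples f p periodic zero = refl
periodic-at-multiples f p periodic (suc q) =
  trans (periodic (q ℕ.* p)) (periodic-at-multiples f p periodic q)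

fib[q*16]%7≡0 : ∀ q → fib (q ℕ.* 16) % 7 ≡ 0
fib[q*16]%7≡0 = periodic-at-multiples (λ m → fib m % 7) 16 (fibonacciLike-%7-period fib fib-isFibonacciLike)

lucas[q*16]%7≡2 : ∀ q → lucas (q ℕ.* 16) % 7 ≡ 2
lucas[q*16]%7≡2 = periodic-at-multiples (λ m → lucas m % 7) 16 (fibonacciLike-%7-period lucas lucas-isFibonacciLike)

pos-by-residue : ∀ n {d r} .{{_ : ℕ.NonZero d}} → n % d ≡ r → + n ≡ + r + + d * + (n / d)
pos-by-residue n {d} {r} n%d≡r = begin
  + n                         ≡⟨ cong +_ (m≡m%n+[m/n]*n n d) ⟩
  + (n % d ℕ.+ n / d ℕ.* d)   ≡⟨ pos-+ (n % d) (n / d ℕ.* d) ⟩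
  + (n % d) + + (n / d ℕ.* d) ≡⟨ cong₂ _+_ (cong +_ n%d≡r) (trans (pos-* (n / d) d) (*-comm (+ (n / d)) (+ d))) ⟩
  + r + + d * + (n / d)       ∎
  where open ≡-Reasoning


legendre-±8F+9L≡1 : ∀ F L → F % 7 ≡ 0 → L % 7 ≡ 2 →
  (legendre (+ 8 * + F + + 9 * + L) 7 ≡ + 1) × (legendre (- (+ 8 * + F) + + 9 * + L) 7 ≡ + 1)
legendre-±8F+9L≡1 F L F%7≡0 L%7≡2 =
    trans (cong (λ a → legendre a 7) plus-sign) (legendre-4+7k (+ 2 + + 8 * x + + 9 * y))
  , trans (cong (λ a → legendre a 7) minus-sign) (legendre-4+7k (+ 2 - + 8 * x + + 9 * y))
  where
  x = + (F / 7)
  y = + (L / 7)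
  F≡7x : + F ≡ + 0 + + 7 * x
  F≡7x = pos-by-residue F F%7≡0
  L≡2+7y : + L ≡ + 2 + + 7 * y
  L≡2+7y = pos-by-residue L L%7≡2
  plus-identity : ∀ x y → + 8 * (+ 0 + + 7 * x) + + 9 * (+ 2 + + 7 * y) ≡ + 4 + + 7 * (+ 2 + + 8 * x + + 9 * y)
  plus-identity = solve-∀
  minus-identity : ∀ x y → - (+ 8 * (+ 0 + + 7 * x)) + + 9 * (+ 2 + + 7 * y) ≡ + 4 + + 7 * (+ 2 - + 8 * x + + 9 * y)
  minus-identity = solve-∀
  plus-sign : + 8 * + F + + 9 * + L ≡ + 4 + + 7 * (+ 2 + + 8 * x + + 9 * y)
  plus-sign = trans (cong₂ (λ f l → + 8 * f + + 9 * l) F≡7x L≡2+7y) (plus-identity x y)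
  minus-sign : - (+ 8 * + F) + + 9 * + L ≡ + 4 + + 7 * (+ 2 - + 8 * x + + 9 * y)
  minus-sign = trans (cong₂ (λ f l → - (+ 8 * f) + + 9 * l) F≡7x L≡2+7y) (minus-identity x y)

lemma3 : (m : ℕ) → 16 ∣ m →
    (legendre ((+ 8) * (+ fib m) + (+ 9) * (+ lucas m)) 7 ≡ + 1)
    × (legendre (- ((+ 8) * (+ fib m)) + (+ 9) * (+ lucas m)) 7 ≡ + 1)
lemma3 m (divides q refl) =
  legendre-±8F+9L≡1 (fib (q ℕ.* 16)) (lucas (q ℕ.* 16)) (fib[q*16]%7≡0 q) (lucas[q*16]%7≡2 q)
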